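{- Let $S:\mathbb{N}_0\times\mathbb{N}_0\to\mathbb{Z}$ be a function with $S(g,h)=0$ whenever $h>g+1$. Define $T_S(g,h)$ for integers $g,h$ by: $T_S(g,h)=0$ whenever $h>g+1$, and for $g\ge 0$, $h\ge 0$, \[ T_S(g,h)=T_S(g,h+1)+T_S(g-1,h+1)+S(g,h). \] Then for all $g,h\ge 0$, \[ T_S(g,h)=\sum_{x,y\ge 0}\binom{y-h}{g-x}S(x,y). \]
   Context: Convention: $\binom{n}{k}=0$ whenever $k<0$ or $k>n$ (for any integers $n,k$). The recursion determines $T_S(g,h)$ for $g,h\ge0$ by downward induction on $h$ (for fixed $g$) since $T_S(g,h)=0$ for $h>g+1$. -}

module Defs where

open import Data.Nat using (ℕ; zero; suc)
open import Data.Nat.Combinatorics using (_C_)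
open import Data.Integer using (ℤ; +_; -[1+_]; _+_)

-- Binomial coefficient with integer arguments, with the convention
-- binom n k = 0 whenever k < 0 or k > n.  For n,k ≥ 0 this is the usual
-- n C k (which is 0 for k > n); if k ≥ 0 and n < 0 then k > n, so 0.
binomℤ : ℤ → ℤ → ℤ
binomℤ (+ n)      (+ k)      = + (n C k)
binomℤ (+ n)      -[1+ k ]   = + 0
binomℤ -[1+ n ]   _          = + 0

sumBelow : ℕ → (ℕ → ℤ) → ℤ
sumBelow zero    f = + 0
sumBelow (suc n) f = sumBelow n f + f n

-- Write F(g,h) for the double sum.  Pascal's rule, which holds on all of ℤ² once a
-- Kronecker delta at (0,0) is added, splits each binomial of F(g,h) into those of
-- F(g,h+1) and F(g-1,h+1), and the delta terms sift out S(g,h); so F satisfies the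
-- recursion of T.  F also vanishes above the line h = g + 1, because a nonzero term
-- needs x ≤ g and y ≤ x + 1.  A function vanishing there is determined by the
-- recursion, by induction on the column g and downward induction on h within it.

module Submission where

open import Defs
open import Data.Nat using (ℕ; zero; suc)
import Data.Nat as ℕ
import Data.Nat.Properties as ℕ
open import Data.Nat.Combinatorics using (_C_; nCk+nC[k+1]≡[n+1]C[k+1])
open import Data.Integer using (ℤ; +_; -[1+_]; 0ℤ; 1ℤ; _+_; _-_; -_; _*_; _<_; _>_; +<+; +≤+)
import Data.Integer.Properties as ℤ
open import Data.Integer.Tactic.RingSolver using (solve-∀)
open import Relation.Binary.PropositionalEquality
  using (_≡_; _≢_; ≢-sym; refl; sym; trans; cong; cong₂; subst; module ≡-Reasoning)
open import Relation.Nullary using (yes; no; contradiction)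

sumBelow-+ : ∀ n (f g : ℕ → ℤ) → sumBelow n (λ i → f i + g i) ≡ sumBelow n f + sumBelow n g
sumBelow-+ zero    f g = refl
sumBelow-+ (suc n) f g = trans (cong (_+ (f n + g n)) (sumBelow-+ n f g))
                               (interchange (sumBelow n f) (sumBelow n g) (f n) (g n))
  where
  interchange : ∀ a b c d → (a + b) + (c + d) ≡ (a + c) + (b + d)
  interchange = solve-∀

sumBelow-cong : ∀ n {f g : ℕ → ℤ} → (∀ i → i ℕ.< n → f i ≡ g i) → sumBelow n f ≡ sumBelow n g
sumBelow-cong zero    f≗g = refl
sumBelow-cong (suc n) f≗g =
  cong₂ _+_ (sumBelow-cong n (λ i i<n → f≗g i (ℕ.m<n⇒m<1+n i<n))) (f≗g n ℕ.≤-refl)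

sumBelow-zero : ∀ n {f : ℕ → ℤ} → (∀ i → i ℕ.< n → f i ≡ 0ℤ) → sumBelow n f ≡ 0ℤ
sumBelow-zero zero    f≗0 = refl
sumBelow-zero (suc n) f≗0 =
  cong₂ _+_ (sumBelow-zero n (λ i i<n → f≗0 i (ℕ.m<n⇒m<1+n i<n))) (f≗0 n ℕ.≤-refl)

sumBelow-single : ∀ n (f : ℕ → ℤ) {j} → j ℕ.< n →
                  (∀ i → i ℕ.< n → i ≢ j → f i ≡ 0ℤ) → sumBelow n f ≡ f j
sumBelow-single (suc n) f {j} j<1+n f≗0 with j ℕ.≟ n
... | yes refl = trans (cong (_+ f j) (sumBelow-zero n λ i i<n →
                          f≗0 i (ℕ.m<n⇒m<1+n i<n) (ℕ.<⇒≢ i<n)))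
                       (ℤ.+-identityˡ (f j))
... | no j≢n = trans (cong₂ _+_ (sumBelow-single n f (ℕ.≤∧≢⇒< (ℕ.≤-pred j<1+n) j≢n)
                                   (λ i i<n → f≗0 i (ℕ.m<n⇒m<1+n i<n)))
                                (f≗0 n ℕ.≤-refl (≢-sym j≢n)))
                     (ℤ.+-identityʳ (f j))

doubleSum : ℕ → (ℕ → ℕ → ℤ) → ℤ
doubleSum N f = sumBelow N (λ x → sumBelow N (f x))

doubleSum-+ : ∀ N (f g : ℕ → ℕ → ℤ) →
              doubleSum N (λ x y → f x y + g x y) ≡ doubleSum N f + doubleSum N g
doubleSum-+ N f g = trans (sumBelow-cong N (λ x _ → sumBelow-+ N (f x) (g x)))
                          (sumBelow-+ N (λ x → sumBelow N (f x)) (λ x → sumBelow N (g x)))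

doubleSum-cong : ∀ N {f g : ℕ → ℕ → ℤ} → (∀ x y → f x y ≡ g x y) → doubleSum N f ≡ doubleSum N g
doubleSum-cong N f≗g = sumBelow-cong N (λ x _ → sumBelow-cong N (λ y _ → f≗g x y))

δ : ℤ → ℤ
δ (+ zero) = 1ℤ
δ _        = 0ℤ

δ-refl : ∀ n → δ (+ n - + n) ≡ 1ℤ
δ-refl n = cong δ (ℤ.+-inverseʳ (+ n))

δ-≢ : ∀ {m n} → m ≢ n → δ (+ m - + n) ≡ 0ℤ
δ-≢ {m} {n} m≢n with + m - + n in eq
... | + zero  = contradiction (ℤ.+-injective (ℤ.i-j≡0⇒i≡j (+ m) (+ n) eq)) m≢n
... | + suc _ = refl
... | -[1+ _ ] = refl

binomℤ-negative-top : ∀ {n} k → n < 0ℤ → binomℤ n k ≡ 0ℤ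
binomℤ-negative-top { -[1+ _ ]} k _         = refl
binomℤ-negative-top {+ _}      k (+<+ ())

binomℤ-negative-bottom : ∀ n {k} → k < 0ℤ → binomℤ n k ≡ 0ℤ
binomℤ-negative-bottom (+ _)    { -[1+ _ ]} _ = refl
binomℤ-negative-bottom -[1+ _ ] { -[1+ _ ]} _ = refl
binomℤ-negative-bottom n        {+ _}      (+<+ ())

binomℤ-pascal : ∀ n k → binomℤ n k ≡ binomℤ (n - 1ℤ) k + binomℤ (n - 1ℤ) (k - 1ℤ) + δ n * δ k
binomℤ-pascal -[1+ _ ]  k          = refl
binomℤ-pascal (+ zero)  (+ zero)   = refl
binomℤ-pascal (+ zero)  (+ suc _)  = refl
binomℤ-pascal (+ zero)  -[1+ _ ]   = refl
binomℤ-pascal (+ suc _) (+ zero)   = refl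
binomℤ-pascal (+ suc _) -[1+ _ ]   = refl
binomℤ-pascal (+ suc m) (+ suc k)  = begin
  + (suc m C suc k)              ≡⟨ cong +_ (sym (nCk+nC[k+1]≡[n+1]C[k+1] m k)) ⟩
  + (m C k ℕ.+ m C suc k)        ≡⟨ cong +_ (ℕ.+-comm (m C k) (m C suc k)) ⟩
  + (m C suc k) + + (m C k)      ≡⟨ sym (ℤ.+-identityʳ _) ⟩
  + (m C suc k) + + (m C k) + 0ℤ ∎
  where open ≡-Reasoning

i<j⇒i-j<0 : ∀ {i j} → i < j → i - j < 0ℤ
i<j⇒i-j<0 {i} {j} i<j = subst (i - j <_) (ℤ.+-inverseʳ j) (ℤ.+-monoˡ-< (- j) i<j)

binomialTransform : (ℕ → ℕ → ℤ) → ℕ → ℤ → ℤ → ℤ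
binomialTransform S N G H = doubleSum N (λ x y → binomℤ (+ y - H) (G - + x) * S x y)

binomialTransform-vanishes : ∀ (S : ℕ → ℕ → ℤ) → (∀ x y → suc x ℕ.< y → S x y ≡ 0ℤ) →
                             ∀ N G H → H > G + 1ℤ → binomialTransform S N G H ≡ 0ℤ
binomialTransform-vanishes S S-vanishes N G H H>G+1 =
  sumBelow-zero N (λ x _ → sumBelow-zero N (λ y _ → term-vanishes x y))
  where
  term-vanishes : ∀ x y → binomℤ (+ y - H) (G - + x) * S x y ≡ 0ℤ
  term-vanishes x y with G - + x ℤ.<? 0ℤ | suc x ℕ.<? y
  ... | yes G-x<0 | _         = cong (_* S x y) (binomℤ-negative-bottom (+ y - H) G-x<0)
  ... | no _      | yes 1+x<y = trans (cong (b *_) (S-vanishes x y 1+x<y)) (ℤ.*-zeroʳ b)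
    where b = binomℤ (+ y - H) (G - + x)
  ... | no G-x≮0  | no 1+x≮y  = cong (_* S x y) (binomℤ-negative-top (G - + x) (i<j⇒i-j<0 y<H))
    where
    open ℤ.≤-Reasoning
    y<H : + y < H
    y<H = begin-strict
      + y      ≤⟨ +≤+ (ℕ.≤-trans (ℕ.≮⇒≥ 1+x≮y) (ℕ.≤-reflexive (ℕ.+-comm 1 x))) ⟩
      + x + 1ℤ ≤⟨ ℤ.+-monoˡ-≤ 1ℤ (ℤ.0≤i-j⇒j≤i {G} {+ x} (ℤ.≮⇒≥ G-x≮0)) ⟩
      G + 1ℤ   <⟨ H>G+1 ⟩
      H        ∎

doubleSum-δ : ∀ {N g h} (S : ℕ → ℕ → ℤ) → g ℕ.< N → h ℕ.< N →
              doubleSum N (λ x y → δ (+ y - + h) * δ (+ g - + x) * S x y) ≡ S g h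
doubleSum-δ {N} {g} {h} S g<N h<N = begin
  doubleSum N (λ x y → δ (+ y - + h) * δ (+ g - + x) * S x y)
    ≡⟨ sumBelow-single N _ g<N (λ x _ x≢g → sumBelow-zero N (λ y _ → off-column x≢g y)) ⟩
  sumBelow N (λ y → δ (+ y - + h) * δ (+ g - + g) * S g y)
    ≡⟨ sumBelow-single N _ h<N (λ y _ y≢h → cong (λ d → d * δ (+ g - + g) * S g y) (δ-≢ y≢h)) ⟩
  δ (+ h - + h) * δ (+ g - + g) * S g h
    ≡⟨ cong₂ (λ a b → a * b * S g h) (δ-refl h) (δ-refl g) ⟩
  1ℤ * 1ℤ * S g h
    ≡⟨ ℤ.*-identityˡ (S g h) ⟩
  S g h ∎
  where
  open ≡-Reasoning
  off-column : ∀ {x} → x ≢ g → ∀ y → δ (+ y - + h) * δ (+ g - + x) * S x y ≡ 0ℤ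
  off-column {x} x≢g y = trans (cong (λ d → δ (+ y - + h) * d * S x y) (δ-≢ (≢-sym x≢g)))
                               (cong (_* S x y) (ℤ.*-zeroʳ (δ (+ y - + h))))

binomialTransform-recursion : ∀ (S : ℕ → ℕ → ℤ) {N g h} → g ℕ.< N → h ℕ.< N →
  binomialTransform S N (+ g) (+ h) ≡
  binomialTransform S N (+ g) (+ h + 1ℤ) + binomialTransform S N (+ g - 1ℤ) (+ h + 1ℤ) + S g h
binomialTransform-recursion S {N} {g} {h} g<N h<N = begin
  doubleSum N (λ x y → binomℤ (+ y - + h) (+ g - + x) * S x y)
    ≡⟨ doubleSum-cong N pascal-term ⟩
  doubleSum N (λ x y → A x y + B x y + Δ x y)
    ≡⟨ doubleSum-+ N (λ x y → A x y + B x y) Δ ⟩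
  doubleSum N (λ x y → A x y + B x y) + doubleSum N Δ
    ≡⟨ cong₂ _+_ (doubleSum-+ N A B) (doubleSum-δ S g<N h<N) ⟩
  doubleSum N A + doubleSum N B + S g h ∎
  where
  open ≡-Reasoning
  A B Δ : ℕ → ℕ → ℤ
  A x y = binomℤ (+ y - (+ h + 1ℤ)) (+ g - + x) * S x y
  B x y = binomℤ (+ y - (+ h + 1ℤ)) ((+ g - 1ℤ) - + x) * S x y
  Δ x y = δ (+ y - + h) * δ (+ g - + x) * S x y

  pascal-term : ∀ x y → binomℤ (+ y - + h) (+ g - + x) * S x y ≡ A x y + B x y + Δ x y
  pascal-term x y = begin
    binomℤ n k * s
      ≡⟨ cong (_* s) (binomℤ-pascal n k) ⟩
    (binomℤ (n - 1ℤ) k + binomℤ (n - 1ℤ) (k - 1ℤ) + δ n * δ k) * s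
      ≡⟨ distribʳ (binomℤ (n - 1ℤ) k) (binomℤ (n - 1ℤ) (k - 1ℤ)) (δ n * δ k) s ⟩
    binomℤ (n - 1ℤ) k * s + binomℤ (n - 1ℤ) (k - 1ℤ) * s + δ n * δ k * s
      ≡⟨ cong₂ (λ n′ k′ → binomℤ n′ k * s + binomℤ n′ k′ * s + δ n * δ k * s)
               (sub-sub (+ y) (+ h)) (sub-comm (+ g) (+ x)) ⟩
    A x y + B x y + Δ x y ∎
    where
    n = + y - + h
    k = + g - + x
    s = S x y
    distribʳ : ∀ a b c s → (a + b + c) * s ≡ a * s + b * s + c * s
    distribʳ = solve-∀
    sub-sub : ∀ a b → a - b - 1ℤ ≡ a - (b + 1ℤ)
    sub-sub = solve-∀
    sub-comm : ∀ a b → a - b - 1ℤ ≡ a - 1ℤ - b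
    sub-comm = solve-∀

module Uniqueness (S : ℕ → ℕ → ℤ) (N : ℕ) {T U : ℤ → ℤ → ℤ}
  (T-vanishes : ∀ g h → h > g + 1ℤ → T g h ≡ 0ℤ)
  (U-vanishes : ∀ g h → h > g + 1ℤ → U g h ≡ 0ℤ)
  (T-recursion : ∀ {g h} → g ℕ.< N → h ℕ.< N →
                 T (+ g) (+ h) ≡ T (+ g) (+ h + 1ℤ) + T (+ g - 1ℤ) (+ h + 1ℤ) + S g h)
  (U-recursion : ∀ {g h} → g ℕ.< N → h ℕ.< N →
                 U (+ g) (+ h) ≡ U (+ g) (+ h + 1ℤ) + U (+ g - 1ℤ) (+ h + 1ℤ) + S g h)
  where

  agree-above : ∀ {g h} → h > g + 1ℤ → T g h ≡ U g h
  agree-above {g} {h} h>g+1 = trans (T-vanishes g h h>g+1) (sym (U-vanishes g h h>g+1))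

  column-agrees : ∀ {g} → suc (suc g) ℕ.≤ N →
                  (∀ h → T (+ g - 1ℤ) (+ h + 1ℤ) ≡ U (+ g - 1ℤ) (+ h + 1ℤ)) →
                  ∀ h → T (+ g) (+ h) ≡ U (+ g) (+ h)
  column-agrees {g} g+2≤N left-column-agrees h = downward (suc (suc g)) h (ℕ.m≤n+m _ h)
    where
    -- k bounds the number of steps from h up to the vanishing region h ≥ g + 2
    downward : ∀ k h → suc (suc g) ℕ.≤ h ℕ.+ k → T (+ g) (+ h) ≡ U (+ g) (+ h)
    downward k h _ with suc (suc g) ℕ.≤? h
    downward k       h _         | yes g+2≤h =
      agree-above (+<+ (subst (ℕ._< h) (ℕ.+-comm 1 g) g+2≤h))
    downward zero    h g+2≤h+0   | no  g+2≰h =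
      contradiction (subst (suc (suc g) ℕ.≤_) (ℕ.+-identityʳ h) g+2≤h+0) g+2≰h
    downward (suc k) h g+2≤h+1+k | no  g+2≰h = begin
      T (+ g) (+ h)
        ≡⟨ T-recursion g<N h<N ⟩
      T (+ g) (+ h + 1ℤ) + T (+ g - 1ℤ) (+ h + 1ℤ) + S g h
        ≡⟨ cong₂ (λ a b → a + b + S g h) (downward k (h ℕ.+ 1) g+2≤h+1+k′) (left-column-agrees h) ⟩
      U (+ g) (+ h + 1ℤ) + U (+ g - 1ℤ) (+ h + 1ℤ) + S g h
        ≡⟨ sym (U-recursion g<N h<N) ⟩
      U (+ g) (+ h) ∎
      where
      open ≡-Reasoning
      g<N : g ℕ.< N
      g<N = ℕ.≤-trans (ℕ.n≤1+n (suc g)) g+2≤N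
      h<N : h ℕ.< N
      h<N = ℕ.<-≤-trans (ℕ.≰⇒> g+2≰h) g+2≤N
      g+2≤h+1+k′ : suc (suc g) ℕ.≤ h ℕ.+ 1 ℕ.+ k
      g+2≤h+1+k′ = subst (suc (suc g) ℕ.≤_) (sym (ℕ.+-assoc h 1 k)) g+2≤h+1+k

  agree : ∀ g → suc (suc g) ℕ.≤ N → ∀ h → T (+ g) (+ h) ≡ U (+ g) (+ h)
  agree zero    2≤N   = column-agrees 2≤N (λ h → agree-above (+<+ (ℕ.m≤n+m 1 h)))
  agree (suc g) g+3≤N = column-agrees g+3≤N (λ h → agree g (ℕ.<⇒≤ g+3≤N) (h ℕ.+ 1))

lemma6 : (S : ℕ → ℕ → ℤ)
         → (∀ (g h : ℕ) → suc g Data.Nat.< h → S g h ≡ + 0)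
         → (T : ℤ → ℤ → ℤ)
         → (∀ (g h : ℤ) → h > g + 1ℤ → T g h ≡ + 0)
         → (∀ (g h : ℕ) → T (+ g) (+ h) ≡ T (+ g) (+ h + 1ℤ) + T (+ g - 1ℤ) (+ h + 1ℤ) + S g h)
         → ∀ (g h : ℕ) (N : ℕ) → suc (suc g) Data.Nat.≤ N
         → T (+ g) (+ h) ≡ sumBelow N (λ x → sumBelow N (λ y → binomℤ (+ y - + h) (+ g - + x) Data.Integer.* S x y))
lemma6 S S-vanishes T T-vanishes T-recursion g h N g+2≤N =
  Uniqueness.agree S N T-vanishes (binomialTransform-vanishes S S-vanishes N)
    (λ _ _ → T-recursion _ _) (binomialTransform-recursion S) g g+2≤N h
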